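{- Let $H$ be a balanced hypergraph with hypervertex set $V$ and hyperedge set $E$, let $U$ be an independent transversal of $H$, and let $H'$ be constructed from $(H,U)$ as described in the context. Let $(R,\sigma)$ be an assignment for $(H',v_0)$. Then: (1) if $\sigma(v_0)=\perp$, Player 1 has a winning strategy in the game $\mathcal{G}(H',v_0)$; (2) if $\sigma(v_0)\neq\perp$, Player 2 has a winning strategy in the game $\mathcal{G}(H',v_0)$.
   Context: A hypergraph is represented as a finite bipartite graph $H=(W,F)$ with bipartition $W=V\cup E$; elements of $V$ are hypervertices, elements of $E$ hyperedges, and $u\in V$ is incident to $e\in E$ iff $ue\in F$. $N_H(x)$ is the set of neighbours of $x$ in this bipartite graph. A path is a sequence $z_1\ldots z_k$ of pairwise distinct elements of $W$ with consecutive ones adjacent; a cycle is a sequence $z_1\ldots z_k$ with consecutive ones adjacent, $z_1=z_k$, and otherwise pairwise distinct elements; the length of $z_1\ldots z_k$ is $k-1$. A path or cycle $z_1\ldots z_k$ is strong iff the subgraph induced by $\{z_1,\ldots,z_k\}$ contains exactly the edges $z_iz_{i+1}$ ($1\le i<k$). $H$ is balanced iff it has no strong cycle of length $4k+2$ for an integer $k\ge1$. A set $S\subseteq V$ is independent if every hyperedge is incident to at most one element of $S$; $T\subseteq V$ is a transversal if every hyperedge is incident to at least one element of $T$. $H'$ is obtained from $H$ by adding two new hypervertices $v_0,v_1$, a new hyperedge $e_0$ incident exactly to $v_0,v_1$, and for each $v\in U$ a new hyperedge $f_v$ incident exactly to $v_1$ and $v$; $V',E'$ denote the hypervertex and hyperedge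 sets of $H'$. For $\sigma:V'\to E'\cup\{\perp\}$ ($\perp$ a symbol not in $E'$) and $u\in V'$, let $N_\sigma(u)=\{v\in V'\setminus\{u\}:\sigma(v)\text{ is a hyperedge incident to }u\text{ in }H'\}$. An assignment for $(H',v_0)$ is a pair $(R,\sigma)$ with $R\subseteq V'$, $v_0\in R$, $\sigma:V'\to E'\cup\{\perp\}$ such that: (C1) for $v\in R$, if $\sigma(v)=e\in E'$ then $e\in N_{H'}(v)$ and every $u\in N_{H'}(e)\setminus\{v\}$ satisfies $u\in R$ and $\sigma(u)=\perp$; (C2) for $v\in R$, if $\sigma(v)=\perp$ then for every $e\in N_{H'}(v)$ there is $u\in N_{H'}(e)$ with $u\in R$ and $\sigma(u)\neq\perp$; (C3) for $v\in R$, $|N_\sigma(v)|\le1$, and $N_\sigma(v_0)=\emptyset$. The game $\mathcal{G}(H',v_0)$: positions are sequences $P=p_0h_0p_1h_1\ldots p_kh_k$ that are strong paths in $H'$ with $p_0=v_0$, $h_0=e_0$ ($p_i\in V'$, $h_i\in E'$). The game starts with $P=v_0e_0$. At position $P=p_0h_0\ldots p_kh_k$ the player to move is Player 1 if $k$ is even and Player 2 if $k$ is odd; that player must choose $v\in V'$, $e\in E'$ such that $P\,v\,e$ is a strong path in $H'$ and append $v,e$ to $P$; a player who cannot do so loses. A winning strategy for a player is a rule choosing his moves that guarantees he wins whatever the opponent plays. -}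

module Defs where

open import Data.Nat using (ℕ; zero; suc; _+_; _*_; _≤_; _%_)
open import Data.Fin using (Fin; toℕ)
open import Data.Bool using (Bool; true; false; T; if_then_else_)
open import Data.Maybe using (Maybe; just; nothing)
open import Data.List using (List; []; _∷_; _++_; length; [_])
open import Data.List.Relation.Unary.All using (All)
open import Data.List.Membership.Propositional using (_∉_)
open import Data.Sum using (_⊎_; inj₁; inj₂)
open import Data.Product using (Σ; ∃; ∃-syntax; _×_; _,_)
open import Data.Unit using (⊤)
open import Data.Empty using (⊥)
open import Relation.Nullary using (¬_)
open import Relation.Binary.PropositionalEquality using (_≡_; _≢_)
open import Function.Definitions using (Injective)

module Graph {W : Set} (Adj : W → W → Set) where

  StrongPath : List W → Set
  StrongPath [] = ⊤
  StrongPath (z ∷ []) = ⊤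
  StrongPath (z ∷ z' ∷ zs) =
    Adj z z' × z ∉ (z' ∷ zs) × All (λ y → ¬ Adj z y) zs × StrongPath (z' ∷ zs)

  CycConsec : (L : ℕ) → Fin L → Fin L → Set
  CycConsec L i j =
    (suc (toℕ i) ≡ toℕ j) ⊎ (suc (toℕ j) ≡ toℕ i)
    ⊎ (suc (toℕ i) ≡ L × toℕ j ≡ 0) ⊎ (suc (toℕ j) ≡ L × toℕ i ≡ 0)

  StrongCycle : (L : ℕ) → (Fin L → W) → Set
  StrongCycle L z =
    Injective _≡_ _≡_ z ×
    (∀ i j → CycConsec L i j → Adj (z i) (z j)) ×
    (∀ i j → Adj (z i) (z j) → CycConsec L i j)

module Hypergraph {n m : ℕ} (inc : Fin n → Fin m → Bool) where

  W : Set
  W = Fin n ⊎ Fin m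

  Adj : W → W → Set
  Adj (inj₁ v) (inj₂ e) = T (inc v e)
  Adj (inj₂ e) (inj₁ v) = T (inc v e)
  Adj _ _ = ⊥

  open Graph Adj public

  Balanced : Set
  Balanced = ∀ (k : ℕ) → 1 ≤ k → (z : Fin (4 * k + 2) → W) → ¬ StrongCycle (4 * k + 2) z

  Independent : (Fin n → Bool) → Set
  Independent S = ∀ (e : Fin m) (u w : Fin n) → T (S u) → T (S w) →
                  T (inc u e) → T (inc w e) → u ≡ w

  Transversal : (Fin n → Bool) → Set
  Transversal S = ∀ (e : Fin m) → ∃[ u ] (T (S u) × T (inc u e))

data Player : Set where
  Player1 Player2 : Player

isOdd : ℕ → Bool
isOdd zero = false
isOdd (suc k) = if isOdd k then false else true

module Construction {n m : ℕ} (inc : Fin n → Fin m → Bool) (U : Fin n → Bool) where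

  data V' : Set where
    old : Fin n → V'
    v₀ v₁ : V'

  data E' : Set where
    old : Fin m → E'
    e₀ : E'
    f : (v : Fin n) → T (U v) → E'

  Inc' : V' → E' → Set
  Inc' (old u) (old e) = T (inc u e)
  Inc' v₀ e₀ = ⊤
  Inc' v₁ e₀ = ⊤
  Inc' v₁ (f v _) = ⊤
  Inc' (old u) (f v _) = u ≡ v
  Inc' _ _ = ⊥

  W' : Set
  W' = V' ⊎ E'

  Adj' : W' → W' → Set
  Adj' (inj₁ v) (inj₂ e) = Inc' v e
  Adj' (inj₂ e) (inj₁ v) = Inc' v e
  Adj' _ _ = ⊥

  open Graph Adj' public

  -- σ : V' → E' ∪ {⊥}, with ⊥ represented by nothing.
  -- u ∈ N_σ(v)
  _∈Nσ_ : (σ : V' → Maybe E') → V' → V' → Set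
  (σ ∈Nσ u) v = v ≢ u × ∃[ e ] (σ v ≡ just e × Inc' u e)

  record Assignment (R : V' → Bool) (σ : V' → Maybe E') : Set where
    field
      v₀∈R : T (R v₀)
      C1 : ∀ v e → T (R v) → σ v ≡ just e →
           Inc' v e × (∀ u → Inc' u e → u ≢ v → T (R u) × σ u ≡ nothing)
      C2 : ∀ v → T (R v) → σ v ≡ nothing →
           ∀ e → Inc' v e → ∃[ u ] (Inc' u e × T (R u) × σ u ≢ nothing)
      C3 : ∀ v → T (R v) → ∀ a b → (σ ∈Nσ v) a → (σ ∈Nσ v) b → a ≡ b
      C3₀ : ∀ u → ¬ (σ ∈Nσ v₀) u

  -- Game positions: P = p₀h₀…p_kh_k, stored as the list of pairs (p_i , h_i).
  Position : Set
  Position = List (V' × E')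

  flatten : Position → List W'
  flatten [] = []
  flatten ((p , h) ∷ P) = inj₁ p ∷ inj₂ h ∷ flatten P

  -- Player 1 moves iff k is even, i.e. iff length P = k + 1 is odd.
  toMove : Position → Player
  toMove P = if isOdd (length P) then Player1 else Player2

  Legal : Position → V' → E' → Set
  Legal P v e = StrongPath (flatten (P ++ [ (v , e) ]))

  -- Wins pl P : player pl has a winning strategy from position P
  -- (the game is finite, so this is the usual inductive notion: at own
  -- turns pick some legal move keeping a win; at the opponent's turns
  -- every legal reply keeps a win; an opponent with no legal move loses).
  data Wins (pl : Player) : Position → Set where
    move : ∀ {P} → toMove P ≡ pl → (v : V') (e : E') → Legal P v e →
           Wins pl (P ++ [ (v , e) ]) → Wins pl P
    respond : ∀ {P} → toMove P ≢ pl →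
              (∀ v e → Legal P v e → Wins pl (P ++ [ (v , e) ])) → Wins pl P

  start : Position
  start = [ (v₀ , e₀) ]

{-# OPTIONS --safe #-}
module Submission where

-- The player favoured by σ answers each opponent move (q, g) by some w ∈ g ∩ R with
-- σ(w) = e ≠ ⊥, which exists by (C2), and plays (w, e). Any reply (v, h) has v ∈ e, so by
-- (C1) v ∈ R and σ(v) = ⊥, and the pattern repeats. The answer is always legal: w is off the
-- play because only q is adjacent to g; e contains no earlier vertex by (C1) and (C3); and w
-- lies on no earlier hyperedge, since σ-chosen hyperedges are excluded by (C1), while for the
-- last opponent hyperedge h ∋ w the segment of the play from h to g, closed through w, is a
-- strong cycle of H of length 4k + 2. Strong paths repeat no hypervertex, so the game is
-- finite and the opponent eventually has no move.

open import Defs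
open import Data.Nat using (ℕ; zero; suc; _+_; _*_; _<_; _≤_; z≤n; s≤s)
open import Data.Nat.Properties using (+-comm; +-suc; ≤-refl; +-identityʳ; *-suc; ≤-trans; 1+n≰n; m<1+n⇒m<n∨m≡n)
open import Data.Nat.Tactic.RingSolver using (solve-∀)
open import Data.Fin using (Fin; zero; suc; toℕ)
open import Data.Fin.Properties as Finₚ using (toℕ-injective; toℕ<n; injective⇒≤)
open import Data.List using (List; []; _∷_; _++_; _∷ʳ_; length; [_]; lookup)
open import Data.List.Properties using (length-++; ++-assoc)
open import Data.List.Relation.Unary.All as All using (All; []; _∷_)
open import Data.List.Relation.Unary.All.Properties using (++⁻ʳ; ∷ʳ⁺)
open import Data.List.Relation.Unary.Any using (here; there)
open import Data.List.Membership.Propositional using (_∈_; _∉_)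
open import Data.List.Membership.Propositional.Properties using (∈-++⁺ˡ; ∈-++⁺ʳ; ∈-++⁻)
open import Data.Sum using (_⊎_; inj₁; inj₂)
open import Data.Product using (_×_; _,_; proj₁; proj₂; ∃; ∃₂)
open import Data.Unit using (⊤; tt)
open import Data.Bool using (Bool; true; false; T)
open import Data.Maybe using (Maybe; just; nothing)
open import Data.Empty using (⊥; ⊥-elim)
open import Relation.Nullary using (¬_)
open import Function using (_∘_)
open import Function.Definitions using (Injective)
open import Relation.Binary.PropositionalEquality using (_≡_; _≢_; refl; sym; trans; cong; subst)

length-∷ʳ : ∀ {A : Set} (xs : List A) x → length (xs ∷ʳ x) ≡ suc (length xs)
length-∷ʳ xs x = trans (length-++ xs) (+-comm (length xs) 1)

module _ {A : Set} where

  nth : A → List A → ℕ → A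
  nth d [] _ = d
  nth d (x ∷ xs) zero = x
  nth d (x ∷ xs) (suc i) = nth d xs i

  nth-∈ : ∀ d xs {i} → i < length xs → nth d xs i ∈ xs
  nth-∈ d (x ∷ xs) {zero} _ = here refl
  nth-∈ d (x ∷ xs) {suc i} (s≤s i<) = there (nth-∈ d xs i<)

  All-nth : ∀ {P : A → Set} d {xs i} → All P xs → i < length xs → P (nth d xs i)
  All-nth d {i = zero} (px ∷ _) _ = px
  All-nth d {i = suc i} (_ ∷ pxs) (s≤s i<) = All-nth d pxs i<

  nth-++ˡ : ∀ d xs ys {i} → i < length xs → nth d (xs ++ ys) i ≡ nth d xs i
  nth-++ˡ d (x ∷ xs) ys {zero} _ = refl
  nth-++ˡ d (x ∷ xs) ys {suc i} (s≤s i<) = nth-++ˡ d xs ys i<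

  nth-++-length : ∀ d xs y ys → nth d (xs ++ y ∷ ys) (length xs) ≡ y
  nth-++-length d [] y ys = refl
  nth-++-length d (x ∷ xs) y ys = nth-++-length d xs y ys

  ∉-∷ʳ : ∀ {x a : A} {xs} → x ∉ xs → x ≢ a → x ∉ xs ∷ʳ a
  ∉-∷ʳ {xs = xs} x∉ x≢a x∈ with ∈-++⁻ xs x∈
  ... | inj₁ x∈xs = x∉ x∈xs
  ... | inj₂ (here x≡a) = x≢a x≡a

module StrongPaths {W : Set} (Adj : W → W → Set)
                   (Adj-sym : ∀ {a b} → Adj a b → Adj b a) (Adj-irrefl : ∀ {a} → ¬ Adj a a) where
  open Graph Adj

  strongPath-tail : ∀ {x xs} → StrongPath (x ∷ xs) → StrongPath xs
  strongPath-tail {xs = []} _ = tt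
  strongPath-tail {xs = _ ∷ _} (_ , _ , _ , sp) = sp

  strongPath-++⁻ʳ : ∀ xs {ys} → StrongPath (xs ++ ys) → StrongPath ys
  strongPath-++⁻ʳ [] sp = sp
  strongPath-++⁻ʳ (x ∷ xs) sp = strongPath-++⁻ʳ xs (strongPath-tail sp)

  strongPath-consecutive : ∀ d xs {i} → StrongPath xs → suc i < length xs →
                           Adj (nth d xs i) (nth d xs (suc i))
  strongPath-consecutive d (x ∷ []) _ (s≤s ())
  strongPath-consecutive d (x ∷ y ∷ xs) {zero} (xy , _) _ = xy
  strongPath-consecutive d (x ∷ y ∷ xs) {suc i} (_ , _ , _ , sp) (s≤s i<) =
    strongPath-consecutive d (y ∷ xs) sp i<

  strongPath-adjacent : ∀ d xs {i j} → StrongPath xs → i < length xs → j < length xs →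
                        Adj (nth d xs i) (nth d xs j) → suc i ≡ j ⊎ suc j ≡ i
  strongPath-adjacent d (x ∷ []) {zero} {zero} _ _ _ a = ⊥-elim (Adj-irrefl a)
  strongPath-adjacent d (x ∷ []) {suc i} _ (s≤s ())
  strongPath-adjacent d (x ∷ []) {j = suc j} _ _ (s≤s ())
  strongPath-adjacent d (x ∷ y ∷ xs) {zero} {zero} _ _ _ a = ⊥-elim (Adj-irrefl a)
  strongPath-adjacent d (x ∷ y ∷ xs) {zero} {suc zero} _ _ _ _ = inj₁ refl
  strongPath-adjacent d (x ∷ y ∷ xs) {suc zero} {zero} _ _ _ _ = inj₂ refl
  strongPath-adjacent d (x ∷ y ∷ xs) {zero} {suc (suc j)} (_ , _ , x≁ , _) _ (s≤s (s≤s j<)) a =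
    ⊥-elim (All-nth d x≁ j< a)
  strongPath-adjacent d (x ∷ y ∷ xs) {suc (suc i)} {zero} (_ , _ , x≁ , _) (s≤s (s≤s i<)) _ a =
    ⊥-elim (All-nth d x≁ i< (Adj-sym a))
  strongPath-adjacent d (x ∷ y ∷ xs) {suc i} {suc j} (_ , _ , _ , sp) (s≤s i<) (s≤s j<) a
    with strongPath-adjacent d (y ∷ xs) sp i< j< a
  ... | inj₁ e = inj₁ (cong suc e)
  ... | inj₂ e = inj₂ (cong suc e)

  strongPath-nth-injective : ∀ d xs {i j} → StrongPath xs → i < length xs → j < length xs →
                             nth d xs i ≡ nth d xs j → i ≡ j
  strongPath-nth-injective d (x ∷ xs) {zero} {zero} _ _ _ _ = refl
  strongPath-nth-injective d (x ∷ y ∷ xs) {zero} {suc j} (_ , x∉ , _) _ (s≤s j<) e =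
    ⊥-elim (x∉ (subst (_∈ y ∷ xs) (sym e) (nth-∈ d (y ∷ xs) j<)))
  strongPath-nth-injective d (x ∷ y ∷ xs) {suc i} {zero} (_ , x∉ , _) (s≤s i<) _ e =
    ⊥-elim (x∉ (subst (_∈ y ∷ xs) e (nth-∈ d (y ∷ xs) i<)))
  strongPath-nth-injective d (x ∷ y ∷ xs) {suc i} {suc j} (_ , _ , _ , sp) (s≤s i<) (s≤s j<) e =
    cong suc (strongPath-nth-injective d (y ∷ xs) sp i< j< e)

  strongPath-last-neighbour : ∀ xs {l b y} → StrongPath (xs ∷ʳ l ∷ʳ b) → y ∈ xs → ¬ Adj y b
  strongPath-last-neighbour (x ∷ []) (_ , _ , x≁b ∷ [] , _) (here refl) = x≁b
  strongPath-last-neighbour (x ∷ x' ∷ xs) (_ , _ , x≁ , _) (here refl) =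
    All.lookup x≁ (∈-++⁺ʳ _ (here refl))
  strongPath-last-neighbour (x ∷ x' ∷ xs) (_ , _ , _ , sp) (there y∈) =
    strongPath-last-neighbour (x' ∷ xs) sp y∈

  strongPath-∷ʳ : ∀ xs {l a} → StrongPath (xs ∷ʳ l) → Adj l a → a ∉ xs ∷ʳ l →
                  All (λ y → ¬ Adj y a) xs → StrongPath (xs ∷ʳ l ∷ʳ a)
  strongPath-∷ʳ [] _ la a∉ [] = la , ∉-∷ʳ {xs = []} (λ ()) (λ { refl → a∉ (here refl) }) , [] , tt
  strongPath-∷ʳ (x ∷ []) (xl , x∉ , _) la a∉ (x≁a ∷ []) =
    xl , ∉-∷ʳ x∉ (λ { refl → a∉ (here refl) }) , x≁a ∷ [] , strongPath-∷ʳ [] tt la (a∉ ∘ there) []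
  strongPath-∷ʳ (x ∷ x' ∷ xs) (xx' , x∉ , x≁ , sp) la a∉ (x≁a ∷ xs≁a) =
    xx' , ∉-∷ʳ x∉ (λ { refl → a∉ (here refl) }) , ∷ʳ⁺ x≁ x≁a ,
    strongPath-∷ʳ (x' ∷ xs) sp la (a∉ ∘ there) xs≁a

  strongPath-close : ∀ d {x a c} M → StrongPath (a ∷ M ++ [ c ]) → x ∉ a ∷ M ++ [ c ] →
                     Adj a x → Adj c x → All (λ y → ¬ Adj y x) M →
                     StrongCycle (3 + length M) (λ i → nth d (x ∷ a ∷ M ++ [ c ]) (toℕ i))
  strongPath-close d {x} {a} {c} M sp x∉ ax cx M≁x =
    (λ {i} {j} e → toℕ-injective (injective (toℕ<n i) (toℕ<n j) e)) ,
    forward ,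
    (λ i j → backward (toℕ<n i) (toℕ<n j))
    where
      L : List W
      L = a ∷ M ++ [ c ]

      N : ℕ
      N = 3 + length M

      z : ℕ → W
      z = nth d (x ∷ L)

      in-L : ∀ {i} → suc i < N → i < length L
      in-L {i} (s≤s i<) = subst (i <_) (sym (cong suc (length-∷ʳ M c))) i<

      x-neighbour : ∀ {j} → j < length L → Adj (nth d L j) x → j ≡ 0 ⊎ j ≡ suc (length M)
      x-neighbour {zero} _ _ = inj₁ refl
      x-neighbour {suc j} (s≤s j<) adj with m<1+n⇒m<n∨m≡n (subst (j <_) (length-∷ʳ M c) j<)
      ... | inj₁ j<M = ⊥-elim (All-nth d M≁x j<M (subst (λ y → Adj y x) (nth-++ˡ d M [ c ] j<M) adj))
      ... | inj₂ refl = inj₂ refl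

      injective : ∀ {i j} → i < N → j < N → z i ≡ z j → i ≡ j
      injective {zero} {zero} _ _ _ = refl
      injective {zero} {suc j} _ j< e = ⊥-elim (x∉ (subst (_∈ L) (sym e) (nth-∈ d L (in-L j<))))
      injective {suc i} {zero} i< _ e = ⊥-elim (x∉ (subst (_∈ L) e (nth-∈ d L (in-L i<))))
      injective {suc i} {suc j} i< j< e =
        cong suc (strongPath-nth-injective d L sp (in-L i<) (in-L j<) e)

      step : ∀ {i j} → suc i ≡ j → j < N → Adj (z i) (z j)
      step {zero} refl _ = Adj-sym ax
      step {suc i} refl i< = strongPath-consecutive d L sp (in-L i<)

      wrap : ∀ {i j} → suc i ≡ N → j ≡ 0 → Adj (z i) (z j)
      wrap refl refl = subst (λ y → Adj y x) (sym (nth-++-length d M c [])) cx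

      forward : ∀ i j → CycConsec N i j → Adj (z (toℕ i)) (z (toℕ j))
      forward i j (inj₁ e) = step e (toℕ<n j)
      forward i j (inj₂ (inj₁ e)) = Adj-sym (step e (toℕ<n i))
      forward i j (inj₂ (inj₂ (inj₁ (e , e0)))) = wrap e e0
      forward i j (inj₂ (inj₂ (inj₂ (e , e0)))) = Adj-sym (wrap e e0)

      backward : ∀ {i j} → i < N → j < N → Adj (z i) (z j) →
                 suc i ≡ j ⊎ suc j ≡ i ⊎ (suc i ≡ N × j ≡ 0) ⊎ (suc j ≡ N × i ≡ 0)
      backward {zero} {zero} _ _ adj = ⊥-elim (Adj-irrefl adj)
      backward {zero} {suc j} _ j< adj with x-neighbour (in-L j<) (Adj-sym adj)
      ... | inj₁ refl = inj₁ refl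
      ... | inj₂ refl = inj₂ (inj₂ (inj₂ (refl , refl)))
      backward {suc i} {zero} i< _ adj with x-neighbour (in-L i<) adj
      ... | inj₁ refl = inj₂ (inj₁ refl)
      ... | inj₂ refl = inj₂ (inj₂ (inj₁ (refl , refl)))
      backward {suc i} {suc j} i< j< adj with strongPath-adjacent d L sp (in-L i<) (in-L j<) adj
      ... | inj₁ e = inj₁ (cong suc e)
      ... | inj₂ e = inj₂ (inj₁ (cong suc e))

3+[3+4*j]≡4*[1+j]+2 : ∀ j → 3 + (3 + 4 * j) ≡ 4 * suc j + 2
3+[3+4*j]≡4*[1+j]+2 = solve-∀

other : Player → Player
other Player1 = Player2
other Player2 = Player1

other-involutive : ∀ s → other (other s) ≡ s
other-involutive Player1 = refl
other-involutive Player2 = refl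

other-≢ : ∀ s → other s ≢ s
other-≢ Player1 ()
other-≢ Player2 ()

module Extension {n m : ℕ} (inc : Fin n → Fin m → Bool) (U : Fin n → Bool) where
  open Construction inc U
  private module H = Hypergraph inc

  Adj'-sym : ∀ {a b} → Adj' a b → Adj' b a
  Adj'-sym {inj₁ _} {inj₂ _} adj = adj
  Adj'-sym {inj₂ _} {inj₁ _} adj = adj

  Adj'-irrefl : ∀ {a} → ¬ Adj' a a
  Adj'-irrefl {inj₁ _} ()
  Adj'-irrefl {inj₂ _} ()

  open StrongPaths Adj' (λ {a} {b} → Adj'-sym {a} {b}) (λ {a} → Adj'-irrefl {a}) public

  Old : W' → Set
  Old (inj₁ (old _)) = ⊤
  Old (inj₂ (old _)) = ⊤
  Old _ = ⊥

  toH : ∀ a → Old a → H.W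
  toH (inj₁ (old u)) _ = inj₁ u
  toH (inj₂ (old e)) _ = inj₂ e

  toH-injective : ∀ {a b} oa ob → toH a oa ≡ toH b ob → a ≡ b
  toH-injective {inj₁ (old _)} {inj₁ (old _)} _ _ refl = refl
  toH-injective {inj₂ (old _)} {inj₂ (old _)} _ _ refl = refl
  toH-injective {inj₁ (old _)} {inj₂ (old _)} _ _ ()
  toH-injective {inj₂ (old _)} {inj₁ (old _)} _ _ ()

  toH-adj : ∀ {a b} oa ob → Adj' a b → H.Adj (toH a oa) (toH b ob)
  toH-adj {inj₁ (old _)} {inj₂ (old _)} _ _ adj = adj
  toH-adj {inj₂ (old _)} {inj₁ (old _)} _ _ adj = adj

  toH-adj⁻ : ∀ {a b} oa ob → H.Adj (toH a oa) (toH b ob) → Adj' a b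
  toH-adj⁻ {inj₁ (old _)} {inj₂ (old _)} _ _ adj = adj
  toH-adj⁻ {inj₂ (old _)} {inj₁ (old _)} _ _ adj = adj
  toH-adj⁻ {inj₁ (old _)} {inj₁ (old _)} _ _ ()
  toH-adj⁻ {inj₂ (old _)} {inj₂ (old _)} _ _ ()

  strongCycle-toH : ∀ {K} (z : Fin K → W') (o : ∀ i → Old (z i)) → StrongCycle K z →
                    H.StrongCycle K (λ i → toH (z i) (o i))
  strongCycle-toH z o (z-inj , consec⇒adj , adj⇒consec) =
    (λ {i} {j} e → z-inj (toH-injective (o i) (o j) e)) ,
    (λ i j c → toH-adj (o i) (o j) (consec⇒adj i j c)) ,
    (λ i j adj → adj⇒consec i j (toH-adj⁻ (o i) (o j) adj))

  balanced⇒no-old-cycle : H.Balanced → ∀ j {K} → K ≡ 4 * suc j + 2 →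
                          (z : Fin K → W') → (∀ i → Old (z i)) → ¬ StrongCycle K z
  balanced⇒no-old-cycle bal j refl z o cyc = bal (suc j) (s≤s z≤n) _ (strongCycle-toH z o cyc)

  old-neighbour : ∀ {h w} → Old (inj₂ h) → Adj' (inj₂ h) (inj₁ w) → Old (inj₁ w)
  old-neighbour {old _} {old _} _ _ = tt

  flatten-++ : ∀ P Q → flatten (P ++ Q) ≡ flatten P ++ flatten Q
  flatten-++ [] Q = refl
  flatten-++ ((p , h) ∷ P) Q = cong (λ xs → inj₁ p ∷ inj₂ h ∷ xs) (flatten-++ P Q)

  flatten-∷ʳ : ∀ P {p h} → flatten (P ∷ʳ (p , h)) ≡ flatten P ∷ʳ inj₁ p ∷ʳ inj₂ h
  flatten-∷ʳ P = trans (flatten-++ P _) (sym (++-assoc (flatten P) _ _))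

  flatten-∷ʳ-++ : ∀ P {p h} xs → flatten (P ∷ʳ (p , h)) ++ xs ≡ flatten P ++ inj₁ p ∷ inj₂ h ∷ xs
  flatten-∷ʳ-++ P xs = trans (cong (_++ xs) (flatten-++ P _)) (++-assoc (flatten P) _ xs)

  ∈-flatten-∷ʳ⁺ˡ : ∀ P {x p h} → x ∈ flatten P → x ∈ flatten (P ∷ʳ (p , h))
  ∈-flatten-∷ʳ⁺ˡ P x∈ = subst (_ ∈_) (sym (flatten-∷ʳ P)) (∈-++⁺ˡ (∈-++⁺ˡ x∈))

  ∈-flatten-∷ʳ⁺ʳ : ∀ P {p h} → inj₁ p ∈ flatten (P ∷ʳ (p , h))
  ∈-flatten-∷ʳ⁺ʳ P = subst (_ ∈_) (sym (flatten-∷ʳ P)) (∈-++⁺ˡ (∈-++⁺ʳ (flatten P) (here refl)))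

  ∈-flatten-∷ʳ⁻ : ∀ P {v p h} → inj₁ v ∈ flatten (P ∷ʳ (p , h)) → inj₁ v ∈ flatten P ⊎ v ≡ p
  ∈-flatten-∷ʳ⁻ P v∈ with ∈-++⁻ (flatten P ∷ʳ _) (subst (_ ∈_) (flatten-∷ʳ P) v∈)
  ... | inj₂ (here ())
  ... | inj₁ v∈' with ∈-++⁻ (flatten P) v∈'
  ...   | inj₁ v∈P = inj₁ v∈P
  ...   | inj₂ (here refl) = inj₂ refl

  ∉-flatten-∷ʳ : ∀ P {w p h} → inj₁ w ∉ flatten (P ∷ʳ (p , h)) → inj₁ w ∉ flatten P × w ≢ p
  ∉-flatten-∷ʳ P w∉ = w∉ ∘ ∈-flatten-∷ʳ⁺ˡ P , λ { refl → w∉ (∈-flatten-∷ʳ⁺ʳ P) }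

  v₁-after-e₀ : ∀ {a xs} → StrongPath (inj₁ v₀ ∷ inj₂ e₀ ∷ a ∷ xs) → a ≡ inj₁ v₁
  v₁-after-e₀ {inj₁ v₀} (_ , v₀∉ , _) = ⊥-elim (v₀∉ (there (here refl)))
  v₁-after-e₀ {inj₁ v₁} _ = refl
  v₁-after-e₀ {inj₁ (old _)} (_ , _ , _ , () , _)
  v₁-after-e₀ {inj₂ _} (_ , _ , _ , () , _)

  old-after-v₁-edge : ∀ {a b} xs → StrongPath (inj₁ v₀ ∷ inj₂ e₀ ∷ a ∷ b ∷ xs) → All Old xs
  old-after-v₁-edge xs sp with v₁-after-e₀ sp
  old-after-v₁-edge xs (_ , v₀∉ , _ , _ , e₀∉ , _ , _ , v₁∉ , v₁≁ , _) | refl =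
    All.tabulate λ {y} y∈ →
      old-element (λ e → v₀∉ (there (there (there (subst (_∈ xs) (sym e) y∈)))))
          (λ e → e₀∉ (there (there (subst (_∈ xs) (sym e) y∈))))
          (λ e → v₁∉ (there (subst (_∈ xs) (sym e) y∈)))
          (All.lookup v₁≁ y∈)
    where
      old-element : ∀ {y} → inj₁ v₀ ≢ y → inj₂ e₀ ≢ y → inj₁ v₁ ≢ y → ¬ Adj' (inj₁ v₁) y → Old y
      old-element {inj₁ (old _)} _ _ _ _ = tt
      old-element {inj₂ (old _)} _ _ _ _ = tt
      old-element {inj₁ v₀} ≢v₀ _ _ _ = ⊥-elim (≢v₀ refl)
      old-element {inj₁ v₁} _ _ ≢v₁ _ = ⊥-elim (≢v₁ refl)
      old-element {inj₂ e₀} _ ≢e₀ _ _ = ⊥-elim (≢e₀ refl)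
      old-element {inj₂ (f _ _)} _ _ _ ≁v₁ = ⊥-elim (≁v₁ tt)

  -- The hyperedge after v₁ is some f u, and u is the only candidate for the vertex after it.
  edge-after-v₁-closed : ∀ {p h r w} xs → StrongPath (inj₁ v₀ ∷ inj₂ e₀ ∷ p ∷ inj₂ h ∷ r ∷ xs) →
                         inj₁ w ∉ inj₁ v₀ ∷ inj₂ e₀ ∷ p ∷ inj₂ h ∷ r ∷ xs → ¬ Adj' (inj₂ h) (inj₁ w)
  edge-after-v₁-closed {h = h} {r} {w} xs sp w∉ w∈h with v₁-after-e₀ sp
  ... | refl = closed h r w sp w∉ w∈h (All.head (old-after-v₁-edge (r ∷ xs) sp))
    where
      closed : ∀ h r w → StrongPath (inj₁ v₀ ∷ inj₂ e₀ ∷ inj₁ v₁ ∷ inj₂ h ∷ r ∷ xs) →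
               inj₁ w ∉ inj₁ v₀ ∷ inj₂ e₀ ∷ inj₁ v₁ ∷ inj₂ h ∷ r ∷ xs →
               Adj' (inj₂ h) (inj₁ w) → Old r → ⊥
      closed (old _) _ _ (_ , _ , _ , _ , _ , _ , () , _) _ _ _
      closed e₀ _ _ (_ , _ , _ , _ , e₀∉ , _) _ _ _ = e₀∉ (there (here refl))
      closed (f _ _) _ v₀ _ w∉ _ _ = w∉ (here refl)
      closed (f _ _) _ v₁ _ w∉ _ _ = w∉ (there (there (here refl)))
      closed (f _ _) (inj₁ (old _)) (old _) (_ , _ , _ , _ , _ , _ , _ , _ , _ , r∈h , _) w∉ w∈h _ =
        w∉ (there (there (there (there (here (cong (λ u → inj₁ (old u)) (trans w∈h (sym r∈h))))))))

  toMove-∷ʳ : ∀ P x → toMove (P ∷ʳ x) ≡ other (toMove P)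
  toMove-∷ʳ P x rewrite length-∷ʳ P x with isOdd (length P)
  ... | true = refl
  ... | false = refl

  vertex-∈-flatten : ∀ P i → inj₁ (proj₁ (lookup P i)) ∈ flatten P
  vertex-∈-flatten (_ ∷ _) zero = here refl
  vertex-∈-flatten (_ ∷ P) (suc i) = there (there (vertex-∈-flatten P i))

  strongPath-vertices-injective : ∀ P → StrongPath (flatten P) →
                                  Injective _≡_ _≡_ (λ i → proj₁ (lookup P i))
  strongPath-vertices-injective (_ ∷ P) _ {zero} {zero} _ = refl
  strongPath-vertices-injective (_ ∷ P) (_ , p∉ , _) {zero} {suc j} e =
    ⊥-elim (p∉ (there (subst (λ v → inj₁ v ∈ flatten P) (sym e) (vertex-∈-flatten P j))))
  strongPath-vertices-injective (_ ∷ P) (_ , p∉ , _) {suc i} {zero} e =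
    ⊥-elim (p∉ (there (subst (λ v → inj₁ v ∈ flatten P) e (vertex-∈-flatten P i))))
  strongPath-vertices-injective (_ ∷ P) (_ , _ , _ , sp) {suc i} {suc j} e =
    cong suc (strongPath-vertices-injective P (strongPath-tail sp) e)

  encode : V' → Fin (2 + n)
  encode v₀ = zero
  encode v₁ = suc zero
  encode (old u) = suc (suc u)

  encode-injective : Injective _≡_ _≡_ encode
  encode-injective {v₀} {v₀} _ = refl
  encode-injective {v₁} {v₁} _ = refl
  encode-injective {old _} {old _} e = cong old (Finₚ.suc-injective (Finₚ.suc-injective e))

  play-length-bound : ∀ P → StrongPath (flatten P) → length P ≤ 2 + n
  play-length-bound P sp = injective⇒≤ (λ e → strongPath-vertices-injective P sp (encode-injective e))

  e₀-covered : ∀ {a w} xs → StrongPath (inj₁ v₀ ∷ inj₂ e₀ ∷ a ∷ xs) →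
               inj₁ w ∉ inj₁ v₀ ∷ inj₂ e₀ ∷ a ∷ xs → ¬ Inc' w e₀
  e₀-covered {w = v₀} _ _ w∉ _ = w∉ (here refl)
  e₀-covered {w = v₁} _ sp w∉ _ = w∉ (there (there (here (sym (v₁-after-e₀ sp)))))
  e₀-covered {w = old _} _ _ _ ()

  segment-old : ∀ Q {p h c w} S →
                StrongPath (inj₁ v₀ ∷ inj₂ e₀ ∷ flatten Q ++ inj₁ p ∷ inj₂ h ∷ S ++ [ c ]) →
                inj₁ w ∉ inj₁ v₀ ∷ inj₂ e₀ ∷ flatten Q ++ inj₁ p ∷ inj₂ h ∷ S ++ [ c ] →
                Adj' (inj₂ h) (inj₁ w) → All Old (inj₂ h ∷ S ++ [ c ])
  segment-old [] [] sp w∉ w∈h = ⊥-elim (edge-after-v₁-closed [] sp w∉ w∈h)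
  segment-old [] (_ ∷ S) sp w∉ w∈h = ⊥-elim (edge-after-v₁-closed (S ++ _) sp w∉ w∈h)
  segment-old (_ ∷ Q) S sp _ _ = All.tail (++⁻ʳ (flatten Q) (old-after-v₁-edge _ sp))

  edge-of-v₀ : ∀ {e} → Inc' v₀ e → e ≡ e₀
  edge-of-v₀ {e₀} _ = refl

  data Kind : Set where
    σ-move free-move : Kind

  toMoveAfter : Player → Kind → Player
  toMoveAfter s free-move = s
  toMoveAfter s σ-move = other s

  gap : Kind → ℕ
  gap σ-move = 1
  gap free-move = 3

  private variable
    s : Player
    k : Kind
    p q v : V'
    g h : E'
    P : Position

  module Strategy (R : V' → Bool) (σ : V' → Maybe E') (A : Assignment R σ) (bal : H.Balanced) where
    open Assignment A

    σ-clash : ∀ {v h} → σ v ≡ just h → σ v ≢ nothing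
    σ-clash σv≡h σv≡⊥ with trans (sym σv≡h) σv≡⊥
    ... | ()

    -- Play s k q g P: P ends with the move (q, g), player s has answered every opponent move
    -- by a σ-move, and k tells whether (q, g) itself is one.
    data Play : Player → Kind → V' → E' → Position → Set where
      start-free : σ v₀ ≡ nothing → Play Player1 free-move v₀ e₀ start
      start-σ    : σ v₀ ≡ just e₀ → Play Player2 σ-move v₀ e₀ start
      σ-step     : Play s free-move q g P → T (R p) → σ p ≡ just h →
                   Play s σ-move p h (P ∷ʳ (p , h))
      free-step  : Play s σ-move q g P → T (R p) → σ p ≡ nothing →
                   Inc' p g → Inc' p h → p ≢ q → Play s free-move p h (P ∷ʳ (p , h))

    play-R : Play s k q g P → T (R q)
    play-R (start-free _) = v₀∈R
    play-R (start-σ _) = v₀∈R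
    play-R (σ-step _ Rp _) = Rp
    play-R (free-step _ Rp _ _ _ _) = Rp

    play-free : Play s free-move q g P → σ q ≡ nothing
    play-free (start-free σv₀) = σv₀
    play-free (free-step _ _ σp _ _ _) = σp

    play-σ : Play s σ-move q g P → σ q ≡ just g
    play-σ (start-σ σv₀) = σv₀
    play-σ (σ-step _ _ σp) = σp

    play-inc : Play s free-move q g P → Inc' q g
    play-inc (start-free _) = tt
    play-inc (free-step _ _ _ _ p∈h _) = p∈h

    play-init : Play s k q g P → ∃ λ P₀ → P ≡ P₀ ∷ʳ (q , g)
    play-init (start-free _) = [] , refl
    play-init (start-σ _) = [] , refl
    play-init (σ-step {P = P} _ _ _) = P , refl
    play-init (free-step {P = P} _ _ _ _ _ _) = P , refl

    play-start : Play s k q g P → ∃ λ Q → P ≡ (v₀ , e₀) ∷ Q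
    play-start (start-free _) = [] , refl
    play-start (start-σ _) = [] , refl
    play-start (σ-step {p = p} {h = h} pl _ _) with play-start pl
    ... | Q , refl = Q ∷ʳ (p , h) , refl
    play-start (free-step {p = p} {h = h} pl _ _ _ _ _) with play-start pl
    ... | Q , refl = Q ∷ʳ (p , h) , refl

    play-last-∈ : Play s k q g P → inj₁ q ∈ flatten P
    play-last-∈ pl with play-init pl
    ... | P₀ , refl = ∈-flatten-∷ʳ⁺ʳ P₀

    play-turn : Play s k q g P → toMove P ≡ toMoveAfter s k
    play-turn (start-free _) = refl
    play-turn (start-σ _) = refl
    play-turn (σ-step {P = P} pl _ _) = trans (toMove-∷ʳ P _) (cong other (play-turn pl))
    play-turn (free-step {s = s} {P = P} pl _ _ _ _ _) =
      trans (toMove-∷ʳ P _) (trans (cong other (play-turn pl)) (other-involutive s))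

    opponent-move : Play s σ-move q g P → Legal P v h → Play s free-move v h (P ∷ʳ (v , h))
    opponent-move {q = q} {g = g} {v = v} pl legal with play-init pl
    ... | P₀ , refl
      with strongPath-++⁻ʳ (flatten P₀)
             (subst StrongPath (trans (flatten-++ (P₀ ∷ʳ _) _) (flatten-∷ʳ-++ P₀ _)) legal)
    ...   | _ , q∉ , _ , v∈g , _ , _ , v∈h , _ =
      free-step pl (proj₁ v-free) (proj₂ v-free) v∈g v∈h v≢q
      where
        v≢q : v ≢ q
        v≢q refl = q∉ (there (here refl))

        v-free : T (R v) × σ v ≡ nothing
        v-free = proj₂ (C1 q g (play-R pl) (play-σ pl)) v v∈g v≢q

    module Reply {w e} (Rw : T (R w)) (σw : σ w ≡ just e) where

      w∈e : Inc' w e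
      w∈e = proj₁ (C1 w e Rw σw)

      σ-neighbour : ∀ {u} → Inc' u e → w ≢ u → (σ ∈Nσ u) w
      σ-neighbour u∈e w≢u = w≢u , e , σw , u∈e

      unassigned-on-σ-edge : ∀ {u} → Inc' u e → u ≢ w → σ u ≡ nothing
      unassigned-on-σ-edge u∈e u≢w = proj₂ (proj₂ (C1 w e Rw σw) _ u∈e u≢w)

      -- q is already a σ-neighbour of p, so by (C3) w would have to be q.
      free-vertex-∉-σ-edge : Play s σ-move q g P → T (R p) → Inc' p g → p ≢ q →
                             inj₁ w ∉ flatten (P ∷ʳ (p , h)) → ¬ Inc' p e
      free-vertex-∉-σ-edge {q = q} {P = P} pl Rp p∈g p≢q w∉ p∈e with ∉-flatten-∷ʳ P w∉
      ... | w∉P , w≢p = w∉P (subst (λ x → inj₁ x ∈ flatten P) q≡w (play-last-∈ pl))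
        where
          q≡w : q ≡ w
          q≡w = C3 _ Rp q w (p≢q ∘ sym , _ , play-σ pl , p∈g) (σ-neighbour p∈e w≢p)

      σ-partner-∉-play : Play s free-move q g P → StrongPath (flatten P) → Inc' w g → inj₁ w ∉ flatten P
      σ-partner-∉-play pl sp w∈g w∈P with play-init pl
      ... | P₀ , refl with ∈-flatten-∷ʳ⁻ P₀ w∈P
      ...   | inj₁ w∈P₀ =
        strongPath-last-neighbour (flatten P₀) (subst StrongPath (flatten-∷ʳ P₀) sp) w∈P₀ w∈g
      ...   | inj₂ refl = σ-clash σw (play-free pl)

      σ-edge-≢-last : Play s free-move q g P → inj₁ w ∉ flatten P → e ≢ g
      σ-edge-≢-last (start-free _) w∉ refl = C3₀ w (σ-neighbour tt (λ { refl → w∉ (here refl) }))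
      σ-edge-≢-last (free-step pl Rp _ p∈g p∈e p≢q) w∉ refl =
        free-vertex-∉-σ-edge pl Rp p∈g p≢q w∉ p∈e

      σ-edge-avoids-play : Play s k q g P → inj₁ w ∉ flatten P → inj₁ v ∈ flatten P → ¬ Inc' v e
      σ-edge-avoids-play (start-free _) w∉ (here refl) v₀∈e =
        C3₀ w (σ-neighbour v₀∈e (λ { refl → w∉ (here refl) }))
      σ-edge-avoids-play (start-σ σv₀) w∉ (here refl) v₀∈e =
        σ-clash σv₀ (unassigned-on-σ-edge v₀∈e (λ { refl → w∉ (here refl) }))
      σ-edge-avoids-play (start-free _) _ (there (here ()))
      σ-edge-avoids-play (start-free _) _ (there (there ()))
      σ-edge-avoids-play (start-σ _) _ (there (here ()))
      σ-edge-avoids-play (start-σ _) _ (there (there ()))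
      σ-edge-avoids-play (σ-step {P = P} pl _ σp) w∉ v∈ v∈e with ∈-flatten-∷ʳ⁻ P v∈
      ... | inj₁ v∈P = σ-edge-avoids-play pl (proj₁ (∉-flatten-∷ʳ P w∉)) v∈P v∈e
      ... | inj₂ refl = σ-clash σp (unassigned-on-σ-edge v∈e (proj₂ (∉-flatten-∷ʳ P w∉) ∘ sym))
      σ-edge-avoids-play (free-step {P = P} pl Rp _ p∈g _ p≢q) w∉ v∈ v∈e with ∈-flatten-∷ʳ⁻ P v∈
      ... | inj₁ v∈P = σ-edge-avoids-play pl (proj₁ (∉-flatten-∷ʳ P w∉)) v∈P v∈e
      ... | inj₂ refl = free-vertex-∉-σ-edge pl Rp p∈g p≢q w∉ v∈e

      module _ {g F} (spF : StrongPath F) (w∉F : inj₁ w ∉ F) (w∈g : Inc' w g) where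

        private
          ≁w : W' → Set
          ≁w y = ¬ Adj' y (inj₁ w)

        start-avoids : ∀ {l} M → F ≡ inj₁ v₀ ∷ inj₂ e₀ ∷ M ++ [ inj₂ g ] → length M ≡ suc l →
                       All ≁w (inj₁ v₀ ∷ inj₂ e₀ ∷ [])
        start-avoids (_ ∷ M) eq _ =
          (λ ()) ∷ e₀-covered (M ++ _) (subst StrongPath eq spF) (w∉F ∘ subst (_ ∈_) (sym eq)) ∷ []

        -- The segment h M g of the play, closed through w ∈ h, is a strong cycle of H of length
        -- 4 (j + 1) + 2.
        opponent-edge-avoids : ∀ P {p h} j M → (∃ λ Q → P ≡ (v₀ , e₀) ∷ Q) →
                               F ≡ flatten P ++ inj₁ p ∷ inj₂ h ∷ M ++ [ inj₂ g ] →
                               length M ≡ 3 + 4 * j → All ≁w M → ≁w (inj₂ h)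
        opponent-edge-avoids P {h = h} j M (Q , refl) eq len M≁ w∈h =
          balanced⇒no-old-cycle bal j cycle-length _ cycle-old cycle
          where
            sp : StrongPath (flatten P ++ _ ∷ inj₂ h ∷ M ++ [ inj₂ g ])
            sp = subst StrongPath eq spF

            w∉ : inj₁ w ∉ flatten P ++ _ ∷ inj₂ h ∷ M ++ [ inj₂ g ]
            w∉ = w∉F ∘ subst (_ ∈_) (sym eq)

            C : List W'
            C = inj₁ w ∷ inj₂ h ∷ M ++ [ inj₂ g ]

            cycle : StrongCycle (3 + length M) (λ i → nth (inj₁ w) C (toℕ i))
            cycle = strongPath-close (inj₁ w) M (strongPath-tail (strongPath-++⁻ʳ (flatten P) sp))
                      (w∉ ∘ ∈-++⁺ʳ (flatten P) ∘ there) w∈h w∈g M≁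

            segment : All Old (inj₂ h ∷ M ++ [ inj₂ g ])
            segment = segment-old Q M sp w∉ w∈h

            cycle-old : ∀ i → Old (nth (inj₁ w) C (toℕ i))
            cycle-old i = All-nth (inj₁ w) (old-neighbour (All.head segment) w∈h ∷ segment)
              (subst (toℕ i <_) (sym (cong (2 +_) (length-∷ʳ M _))) (toℕ<n i))

            cycle-length : 3 + length M ≡ 4 * suc j + 2
            cycle-length = trans (cong (3 +_) len) (3+[3+4*j]≡4*[1+j]+2 j)

        earlier-edges-avoid : ∀ {s k q h P} j → Play s k q h P → (M : List W') →
                              F ≡ flatten P ++ M ++ [ inj₂ g ] → length M ≡ gap k + 4 * j →
                              All ≁w M → All ≁w (flatten P)
        earlier-edges-avoid j (start-free _) M eq len _ = start-avoids M eq len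
        earlier-edges-avoid j (start-σ _) M eq len _ = start-avoids M eq len
        earlier-edges-avoid j (σ-step {P = P} {p = p} {h = h} pl Rp σp) M eq len M≁ =
          subst (All ≁w) (sym (flatten-∷ʳ P)) (∷ʳ⁺ (∷ʳ⁺ earlier (λ ())) h≁w)
          where
            eq' : F ≡ flatten P ++ inj₁ p ∷ inj₂ h ∷ M ++ [ inj₂ g ]
            eq' = trans eq (flatten-∷ʳ-++ P _)

            w≢p : w ≢ p
            w≢p refl = w∉F (subst (_ ∈_) (sym eq') (∈-++⁺ʳ (flatten P) (here refl)))

            h≁w : ≁w (inj₂ h)
            h≁w w∈h = σ-clash σw (proj₂ (proj₂ (C1 p h Rp σp) w w∈h w≢p))

            earlier : All ≁w (flatten P)
            earlier = earlier-edges-avoid j pl (inj₁ p ∷ inj₂ h ∷ M) eq' (cong (2 +_) len) ((λ ()) ∷ h≁w ∷ M≁)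
        earlier-edges-avoid j (free-step {P = P} {p = p} {h = h} pl _ _ _ _ _) M eq len M≁ =
          subst (All ≁w) (sym (flatten-∷ʳ P)) (∷ʳ⁺ (∷ʳ⁺ earlier (λ ())) h≁w)
          where
            eq' : F ≡ flatten P ++ inj₁ p ∷ inj₂ h ∷ M ++ [ inj₂ g ]
            eq' = trans eq (flatten-∷ʳ-++ P _)

            h≁w : ≁w (inj₂ h)
            h≁w = opponent-edge-avoids P j M (play-start pl) eq' len M≁

            earlier : All ≁w (flatten P)
            earlier = earlier-edges-avoid (suc j) pl (inj₁ p ∷ inj₂ h ∷ M) eq'
                        (trans (cong (2 +_) len) (cong suc (sym (*-suc 4 j)))) ((λ ()) ∷ h≁w ∷ M≁)

      legal-if-earlier-avoid : ∀ P₀ → Play s free-move q g (P₀ ∷ʳ (q , g)) →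
                               StrongPath (flatten (P₀ ∷ʳ (q , g))) → Inc' w g →
                               All (λ y → ¬ Adj' y (inj₁ w)) (flatten P₀ ∷ʳ inj₁ q) →
                               Legal (P₀ ∷ʳ (q , g)) w e
      legal-if-earlier-avoid {q = q} {g = g} P₀ pl sp w∈g earlier≁w =
        subst StrongPath (sym (flatten-∷ʳ (P₀ ∷ʳ _)))
          (strongPath-∷ʳ (flatten (P₀ ∷ʳ _)) with-w w∈e (∉-∷ʳ e∉ (λ ())) (All.tabulate e-avoids))
        where
          w∉ : inj₁ w ∉ flatten (P₀ ∷ʳ (q , g))
          w∉ = σ-partner-∉-play pl sp w∈g

          with-w : StrongPath (flatten (P₀ ∷ʳ (q , g)) ∷ʳ inj₁ w)
          with-w = subst (λ xs → StrongPath (xs ∷ʳ inj₁ w)) (sym (flatten-∷ʳ P₀))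
                     (strongPath-∷ʳ (flatten P₀ ∷ʳ inj₁ q) (subst StrongPath (flatten-∷ʳ P₀) sp) w∈g
                       (w∉ ∘ subst (_ ∈_) (sym (flatten-∷ʳ P₀))) earlier≁w)

          e∉ : inj₂ e ∉ flatten (P₀ ∷ʳ (q , g))
          e∉ e∈ with ∈-++⁻ (flatten P₀ ∷ʳ inj₁ q) (subst (_ ∈_) (flatten-∷ʳ P₀) e∈)
          ... | inj₁ e∈earlier = All.lookup earlier≁w e∈earlier w∈e
          ... | inj₂ (here refl) = σ-edge-≢-last pl w∉ refl

          e-avoids : ∀ {y} → y ∈ flatten (P₀ ∷ʳ (q , g)) → ¬ Adj' y (inj₂ e)
          e-avoids {inj₁ _} v∈ = σ-edge-avoids-play pl w∉ v∈
          e-avoids {inj₂ _} _ ()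

      σ-reply-legal : Play s free-move q g P → StrongPath (flatten P) → Inc' w g → Legal P w e
      σ-reply-legal pl@(start-free _) sp w∈g = legal-if-earlier-avoid [] pl sp w∈g ((λ ()) ∷ [])
      σ-reply-legal pl@(free-step {P = P₀} {p = p} pl' _ _ _ _ _) sp w∈g =
        legal-if-earlier-avoid P₀ pl sp w∈g
          (∷ʳ⁺ (earlier-edges-avoid sp (σ-partner-∉-play pl sp w∈g) w∈g 0 pl' [ inj₁ p ]
                  (flatten-++ P₀ _) refl ((λ ()) ∷ []))
               (λ ()))

    σ-reply : Play s free-move q g P → StrongPath (flatten P) →
              ∃₂ λ w e → Legal P w e × Play s σ-move w e (P ∷ʳ (w , e))
    σ-reply {q = q} {g = g} pl sp with C2 q (play-R pl) (play-free pl) g (play-inc pl)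
    ... | w , w∈g , Rw , σw≢⊥ with σ w in σw
    ...   | nothing = ⊥-elim (σw≢⊥ refl)
    ...   | just e = w , e , Reply.σ-reply-legal Rw σw pl sp w∈g , σ-step pl Rw σw

    fuel-∷ʳ : ∀ (P : Position) {x} fuel → 3 + n ≤ length P + suc fuel → 3 + n ≤ length (P ∷ʳ x) + fuel
    fuel-∷ʳ P {x} fuel =
      subst (3 + n ≤_) (trans (+-suc (length P) fuel) (cong (_+ fuel) (sym (length-∷ʳ P x))))

    wins : ∀ fuel {s k q g P} → Play s k q g P → StrongPath (flatten P) →
           3 + n ≤ length P + fuel → Wins s P
    wins zero {P = P} _ sp enough =
      ⊥-elim (1+n≰n (≤-trans (subst (3 + n ≤_) (+-identityʳ _) enough) (play-length-bound P sp)))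
    wins (suc fuel) {k = free-move} {P = P} pl sp enough with σ-reply pl sp
    ... | w , e , legal , pl' = move (play-turn pl) w e legal (wins fuel pl' legal (fuel-∷ʳ P fuel enough))
    wins (suc fuel) {s} {σ-move} {P = P} pl sp enough =
      respond (other-≢ s ∘ trans (sym (play-turn pl)))
              (λ v h legal → wins fuel (opponent-move pl legal) legal (fuel-∷ʳ P fuel enough))

proposition5 : ∀ {n m : ℕ} (inc : Fin n → Fin m → Bool) (U : Fin n → Bool) →
    Hypergraph.Balanced inc → Hypergraph.Independent inc U → Hypergraph.Transversal inc U →
    (R : Construction.V' inc U → Bool) (σ : Construction.V' inc U → Maybe (Construction.E' inc U)) →
    Construction.Assignment inc U R σ →
    (σ (Construction.v₀) ≡ nothing → Construction.Wins inc U Player1 (Construction.start inc U)) ×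
    (∀ e → σ (Construction.v₀) ≡ just e → Construction.Wins inc U Player2 (Construction.start inc U))
proposition5 {n} inc U balanced _ _ R σ A = player1-wins , player2-wins
  where
    open Construction inc U
    open Extension inc U
    open Strategy R σ A balanced
    open Assignment A

    start-path : StrongPath (flatten start)
    start-path = tt , (λ { (here ()) ; (there ()) }) , [] , tt

    player1-wins : σ v₀ ≡ nothing → Wins Player1 start
    player1-wins σv₀ = wins (2 + n) (start-free σv₀) start-path ≤-refl

    player2-wins : ∀ e → σ v₀ ≡ just e → Wins Player2 start
    player2-wins e σv₀ with edge-of-v₀ {e} (proj₁ (C1 v₀ e v₀∈R σv₀))
    ... | refl = wins (2 + n) (start-σ σv₀) start-path ≤-refl
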